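{- Let $T$ be a tree such that $(T,S)\in\mathscr{U}$ for some labeling $S=(S_A,S_B,S_C)$. Then for every vertex $x\in S_A$ there exists an almost semitotal dominating set of $T$ relative to $x$ of cardinality $\gamma_{t2}(T)-1$.
   Context: For a graph $G$ without isolated vertices, a semitotal dominating set is a set $S$ of vertices such that every vertex outside $S$ has a neighbor in $S$ and every vertex of $S$ is at distance at most $2$ from another vertex of $S$; $\gamma_{t2}(G)$ is its minimum size. An almost semitotal dominating set of $G$ relative to a vertex $v$ is a dominating set $D$ of $G$ such that every vertex of $D$ other than $v$ is at distance at most $2$ from another vertex of $D$. A labeling of a tree $T$ is a partition $(S_A,S_B,S_C)$ of $V(T)$; the status of $v$ is the $x\in\{A,B,C\}$ with $v\in S_x$. The family $\mathscr{U}$ is the smallest family of labeled trees containing $P_3$ with leaves of status $C$ and center of status $A$, and closed under: $\mathscr{P}_1$: for $v$ of status $A$, add a new vertex $u$ of status $C$ and edge $uv$; $\mathscr{P}_2$: for $v$ of status $B$, add a new path $v_1v_2v_3v_4$ and edge $vv_1$ with statuses $B,C,A,C$ for $v_1,v_2,v_3,v_4$; $\mathscr{P}_3$: for $v$ of status $C$, add a new path $v_1v_2v_3v_4v_5$ and edge $vv_1$ with statuses $B,B,C,A,C$ for $v_1,\dots,v_5$ (old statuses unchanged). -}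

module Defs where

open import Data.Nat using (ℕ; zero; suc; _+_; _≤_)
open import Data.Fin using (Fin; zero; suc; _↑ʳ_)
open import Data.Fin.Subset using (Subset; _∈_; _∉_; ∣_∣)
open import Data.List using (List; []; _∷_; map; _++_)
open import Data.List.Membership.Propositional using () renaming (_∈_ to _∈ₗ_)
open import Data.Product using (Σ; ∃; _×_; _,_)
open import Data.Sum using (_⊎_)
open import Relation.Binary.PropositionalEquality using (_≡_)
open import Relation.Nullary using (¬_)
open import Data.Vec.Functional using (Vector) renaming (_∷_ to _∷ᵛ_; _++_ to _++ᵛ_; [] to []ᵛ)

Edges : ℕ → Set
Edges n = List (Fin n × Fin n)

Adj : ∀ {n} → Edges n → Fin n → Fin n → Set
Adj E u v = ((u , v) ∈ₗ E) ⊎ ((v , u) ∈ₗ E)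

-- distance at most 2 between u and w (u ≠ w is required separately)
Dist≤2 : ∀ {n} → Edges n → Fin n → Fin n → Set
Dist≤2 E u w = Adj E u w ⊎ (∃ λ z → Adj E u z × Adj E z w)

Dominating : ∀ {n} → Edges n → Subset n → Set
Dominating E D = ∀ v → v ∉ D → ∃ λ u → u ∈ D × Adj E v u

SemitotalDominating : ∀ {n} → Edges n → Subset n → Set
SemitotalDominating E S =
  Dominating E S × (∀ u → u ∈ S → ∃ λ w → w ∈ S × ¬ (w ≡ u) × Dist≤2 E u w)

IsGammaT2 : ∀ {n} → Edges n → ℕ → Set
IsGammaT2 E k =
  (∃ λ S → SemitotalDominating E S × ∣ S ∣ ≡ k)
  × (∀ S → SemitotalDominating E S → k ≤ ∣ S ∣)

AlmostSemitotalDominating : ∀ {n} → Edges n → Fin n → Subset n → Set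
AlmostSemitotalDominating E v D =
  Dominating E D
  × (∀ u → u ∈ D → ¬ (u ≡ v) → ∃ λ w → w ∈ D × ¬ (w ≡ u) × Dist≤2 E u w)

-- Labeled trees and the family 𝒰.
-- New vertices produced by an operation are put in front (indices 0..k-1);
-- old vertex i becomes raise k i.

data Status : Set where
  A B C : Status

Labeling : ℕ → Set
Labeling n = Vector Status n

raiseE : ∀ {n} k → Edges n → Edges (k + n)
raiseE k E = map (λ { (u , v) → (k ↑ʳ u , k ↑ʳ v) }) E

data InU : (n : ℕ) → Edges n → Labeling n → Set where
  base : InU 3 ((zero , suc zero) ∷ (suc zero , suc (suc zero)) ∷ [])
               (C ∷ᵛ A ∷ᵛ C ∷ᵛ []ᵛ)
  -- P1: new vertex u (=0) of status C, edge u v, v of status A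
  op1 : ∀ {n E st} → InU n E st → (v : Fin n) → st v ≡ A →
        InU (1 + n) ((zero , 1 ↑ʳ v) ∷ raiseE 1 E) (C ∷ᵛ st)
  -- P2: new path v1 v2 v3 v4 (= 0,1,2,3) with statuses B,C,A,C, edge v v1,
  --     v of status B
  op2 : ∀ {n E st} → InU n E st → (v : Fin n) → st v ≡ B →
        InU (4 + n)
            ((4 ↑ʳ v , zero) ∷ (zero , suc zero)
              ∷ (suc zero , suc (suc zero))
              ∷ (suc (suc zero) , suc (suc (suc zero)))
              ∷ raiseE 4 E)
            ((B ∷ᵛ C ∷ᵛ A ∷ᵛ C ∷ᵛ []ᵛ) ++ᵛ st)
  -- P3: new path v1..v5 (= 0..4) with statuses B,B,C,A,C, edge v v1,
  --     v of status C
  op3 : ∀ {n E st} → InU n E st → (v : Fin n) → st v ≡ C →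
        InU (5 + n)
            ((5 ↑ʳ v , zero) ∷ (zero , suc zero)
              ∷ (suc zero , suc (suc zero))
              ∷ (suc (suc zero) , suc (suc (suc zero)))
              ∷ (suc (suc (suc zero)) , suc (suc (suc (suc zero))))
              ∷ raiseE 5 E)
            ((B ∷ᵛ B ∷ᵛ C ∷ᵛ A ∷ᵛ C ∷ᵛ []ᵛ) ++ᵛ st)

module Submission where

-- Let #A be the number of A-vertices.  We prove γ_t2(T) = 2·#A and build an
-- almost semitotal dominating set relative to x of size 2·#A − 1.
--
-- Lower bound.  Every vertex gets an owner, an A-vertex, such that every
-- edge joins two B-vertices or a C-vertex to a non-C-vertex with the same
-- owner.  Hence everything within distance 2 of an A-vertex x is owned by
-- x, and a short case analysis shows that each semitotal dominating set
-- contains two distinct vertices owned by x.  The clusters of vertices with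
-- a common owner partition V(T), so summing over them gives |S| ≥ 2·#A.
--
-- Upper bound.  Along the construction of 𝒰 we build dominating sets that
-- contain every A-vertex: a semitotal one of size 2·#A, one containing any
-- prescribed B-vertex, and, for every A-vertex x, an almost semitotal one
-- relative to x of size 2·#A − 1.  Each operation extends the old sets by a
-- fixed pattern on the new vertices.

open import Defs
open import Data.Nat using (ℕ; zero; suc; _+_; _≤_; z≤n; s≤s)
open import Data.Nat.Properties
  using (+-0-commutativeMonoid; +-identityʳ; +-comm; +-mono-≤; +-monoʳ-≤; ≤-trans; ≤-antisym; m≤m+n; m≤n+m; module ≤-Reasoning)
open import Data.Bool using (Bool; true; false; if_then_else_)
open import Data.Fin using (Fin; zero; suc; _↑ʳ_) renaming (_≟_ to _≟F_)
open import Data.Fin.Patterns using (0F; 1F; 2F; 3F; 4F)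
open import Data.Fin.Properties using (↑ʳ-injective)
open import Data.Fin.Subset using (Subset; _∈_; _∉_; ∣_∣)
open import Data.Fin.Subset.Properties using (_∈?_)
open import Data.Vec using (Vec; _∷_; []; lookup; here; there) renaming (_++_ to _++ᵥ_)
open import Data.Vec.Properties using ([]=⇒lookup)
open import Data.Vec.Functional using () renaming (_∷_ to _∷ᵛ_; _++_ to _++ᵛ_; [] to []ᵛ)
open import Data.List using ([]; _∷_; _++_)
open import Data.List.Relation.Unary.Any using (here; there)
open import Data.List.Membership.Propositional using () renaming (_∈_ to _∈ₗ_)
open import Data.List.Membership.Propositional.Properties using (∈-map⁺; ∈-map⁻; ∈-++⁺ʳ)
open import Data.Product using (∃; ∃₂; _×_; _,_; proj₁; proj₂; map₂)
open import Data.Sum using (inj₁; inj₂)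
open import Data.Empty using (⊥-elim)
open import Data.Unit using (⊤; tt)
open import Function using (_∘_)
open import Relation.Nullary using (¬_; yes; no; does)
open import Relation.Binary.PropositionalEquality
open import Algebra.Properties.CommutativeMonoid.Sum +-0-commutativeMonoid
  using (sum-syntax; ∑-comm; sum-cong-≗; sum-replicate-zero)

∑-point : ∀ {m} (j : Fin m) (c : ℕ) → ∑[ x < m ] (if does (j ≟F x) then c else 0) ≡ c
∑-point {suc m} zero c = trans (cong (c +_) (sum-replicate-zero m)) (+-identityʳ c)
∑-point {suc m} (suc j) c = ∑-point j c

fibre : ∀ {n m} → (Fin n → Fin m) → Fin m → (Fin n → ℕ) → ℕ
fibre {n} o x w = ∑[ i < n ] (if does (o i ≟F x) then w i else 0)

∑-fibres : ∀ {n m} (o : Fin n → Fin m) (w : Fin n → ℕ) →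
           ∑[ i < n ] w i ≡ ∑[ x < m ] fibre o x w
∑-fibres {n} {m} o w = begin
  ∑[ i < n ] w i                      ≡⟨ sum-cong-≗ (λ i → sym (∑-point (o i) (w i))) ⟩
  ∑[ i < n ] ∑[ x < m ] split i x     ≡⟨ ∑-comm split ⟩
  ∑[ x < m ] fibre o x w              ∎
  where
  open ≡-Reasoning
  split : Fin n → Fin m → ℕ
  split i x = if does (o i ≟F x) then w i else 0

∑-mono : ∀ {n} {f g : Fin n → ℕ} → (∀ i → f i ≤ g i) → ∑[ i < n ] f i ≤ ∑[ i < n ] g i
∑-mono {zero} f≤g = z≤n
∑-mono {suc n} f≤g = +-mono-≤ (f≤g zero) (∑-mono (f≤g ∘ suc))

∑-≥-term : ∀ {n} (f : Fin n → ℕ) i → f i ≤ ∑[ j < n ] f j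
∑-≥-term f zero = m≤m+n (f zero) _
∑-≥-term f (suc i) = ≤-trans (∑-≥-term (f ∘ suc) i) (m≤n+m _ (f zero))

∑-≥-pair : ∀ {n} (f : Fin n → ℕ) i j → ¬ i ≡ j → f i + f j ≤ ∑[ k < n ] f k
∑-≥-pair f zero zero i≢j = ⊥-elim (i≢j refl)
∑-≥-pair f zero (suc j) _ = +-monoʳ-≤ (f zero) (∑-≥-term (f ∘ suc) j)
∑-≥-pair f (suc i) zero _ =
  subst (_≤ ∑[ k < suc _ ] f k) (+-comm (f zero) (f (suc i)))
        (+-monoʳ-≤ (f zero) (∑-≥-term (f ∘ suc) i))
∑-≥-pair f (suc i) (suc j) i≢j =
  ≤-trans (∑-≥-pair (f ∘ suc) i j (i≢j ∘ cong suc)) (m≤n+m _ (f zero))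

indicator : ∀ {n} → Subset n → Fin n → ℕ
indicator S i = if lookup S i then 1 else 0

∣∣≡∑indicator : ∀ {n} (S : Subset n) → ∣ S ∣ ≡ ∑[ i < n ] indicator S i
∣∣≡∑indicator [] = refl
∣∣≡∑indicator (true ∷ S) = cong suc (∣∣≡∑indicator S)
∣∣≡∑indicator (false ∷ S) = ∣∣≡∑indicator S

-- Each operation of 𝒰 puts k new vertices in front, so the new edge list
-- has the form  es ++ raiseE k E  with E the old edge list.

Adj-sym : ∀ {n} {E : Edges n} {u v} → Adj E u v → Adj E v u
Adj-sym (inj₁ uv) = inj₂ uv
Adj-sym (inj₂ vu) = inj₁ vu

Adj-lift : ∀ {k n} (es : Edges (k + n)) {E : Edges n} {i j} →
           Adj E i j → Adj (es ++ raiseE k E) (k ↑ʳ i) (k ↑ʳ j)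
Adj-lift es (inj₁ ij) = inj₁ (∈-++⁺ʳ es (∈-map⁺ _ ij))
Adj-lift es (inj₂ ji) = inj₂ (∈-++⁺ʳ es (∈-map⁺ _ ji))

Dist≤2-lift : ∀ {k n} (es : Edges (k + n)) {E : Edges n} {i j} →
              Dist≤2 E i j → Dist≤2 (es ++ raiseE k E) (k ↑ʳ i) (k ↑ʳ j)
Dist≤2-lift es (inj₁ ij) = inj₁ (Adj-lift es ij)
Dist≤2-lift {k} es (inj₂ (z , iz , zj)) = inj₂ (k ↑ʳ z , Adj-lift es iz , Adj-lift es zj)

TwoNeighbours : ∀ {n} → Edges n → Fin n → Set
TwoNeighbours E x = ∃₂ λ c₁ c₂ → ¬ c₁ ≡ c₂ × Adj E x c₁ × Adj E x c₂

TwoNeighbours-lift : ∀ {k n} (es : Edges (k + n)) {E : Edges n} {x} →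
                     TwoNeighbours E x → TwoNeighbours (es ++ raiseE k E) (k ↑ʳ x)
TwoNeighbours-lift {k} es (c₁ , c₂ , c₁≢c₂ , xc₁ , xc₂) =
  k ↑ʳ c₁ , k ↑ʳ c₂ , c₁≢c₂ ∘ ↑ʳ-injective k c₁ c₂ , Adj-lift es xc₁ , Adj-lift es xc₂

another-neighbour : ∀ {n} {E : Edges n} {x} → TwoNeighbours E x →
                    ∀ s → ∃ λ c → ¬ c ≡ s × Adj E x c
another-neighbour (c₁ , c₂ , c₁≢c₂ , xc₁ , xc₂) s with c₁ ≟F s
... | yes refl = c₂ , c₁≢c₂ ∘ sym , xc₂
... | no c₁≢s = c₁ , c₁≢s , xc₁

newEdges₁ : ∀ {n} → Fin n → Edges (1 + n)
newEdges₁ v = (0F , 1 ↑ʳ v) ∷ []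

newEdges₂ : ∀ {n} → Fin n → Edges (4 + n)
newEdges₂ v = (4 ↑ʳ v , 0F) ∷ (0F , 1F) ∷ (1F , 2F) ∷ (2F , 3F) ∷ []

newEdges₃ : ∀ {n} → Fin n → Edges (5 + n)
newEdges₃ v = (5 ↑ʳ v , 0F) ∷ (0F , 1F) ∷ (1F , 2F) ∷ (2F , 3F) ∷ (3F , 4F) ∷ []

pattern old₄ i = suc (suc (suc (suc i)))
pattern old₅ i = suc (old₄ i)
pattern edge₀ = here refl
pattern edge₁ = there edge₀
pattern edge₂ = there edge₁
pattern edge₃ = there edge₂
pattern edge₄ = there edge₃

-- own T u is the A-vertex owning u: an A-vertex owns itself, a C-vertex is
-- owned by its A-neighbour, and a B-vertex by the owner of a neighbour.

own : ∀ {n E st} → InU n E st → Fin n → Fin n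
own base _ = 1F
own (op1 T v _) 0F = suc (own T v)
own (op1 T v _) (suc i) = suc (own T i)
own (op2 T v _) (old₄ i) = 4 ↑ʳ own T i
own (op2 T v _) _ = 2F
own (op3 T v _) 0F = 5 ↑ʳ own T v
own (op3 T v _) (old₅ i) = 5 ↑ʳ own T i
own (op3 T v _) _ = 3F

A≠B : ∀ {s} → s ≡ A → ¬ s ≡ B
A≠B refl ()

A≠C : ∀ {s} → s ≡ A → ¬ s ≡ C
A≠C refl ()

B≠C : ∀ {s} → s ≡ B → ¬ s ≡ C
B≠C refl ()

data EdgeKind {n} (st : Labeling n) (o : Fin n → Fin n) (p q : Fin n) : Set where
  both-B  : st p ≡ B → st q ≡ B → EdgeKind st o p q
  left-C  : st p ≡ C → ¬ st q ≡ C → o p ≡ o q → EdgeKind st o p q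
  right-C : st q ≡ C → ¬ st p ≡ C → o p ≡ o q → EdgeKind st o p q

EdgeKind-raise : ∀ {k n} {E : Edges n} {st : Labeling n} {o : Fin n → Fin n}
                 {st′ : Labeling (k + n)} {o′ : Fin (k + n) → Fin (k + n)} →
                 (∀ i → st′ (k ↑ʳ i) ≡ st i) → (∀ i → o′ (k ↑ʳ i) ≡ k ↑ʳ o i) →
                 (∀ {i j} → (i , j) ∈ₗ E → EdgeKind st o i j) →
                 ∀ {p q} → (p , q) ∈ₗ raiseE k E → EdgeKind st′ o′ p q
EdgeKind-raise {k} st≡ o≡ kind pq with ∈-map⁻ _ pq
... | (i , j) , ij , refl with kind ij
... | both-B i∈B j∈B = both-B (trans (st≡ i) i∈B) (trans (st≡ j) j∈B)
... | left-C i∈C j∉C oi≡oj =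
  left-C (trans (st≡ i) i∈C) (j∉C ∘ trans (sym (st≡ j)))
         (trans (o≡ i) (trans (cong (k ↑ʳ_) oi≡oj) (sym (o≡ j))))
... | right-C j∈C i∉C oi≡oj =
  right-C (trans (st≡ j) j∈C) (i∉C ∘ trans (sym (st≡ i)))
          (trans (o≡ i) (trans (cong (k ↑ʳ_) oi≡oj) (sym (o≡ j))))

edgeKind : ∀ {n E st} (T : InU n E st) {p q} → (p , q) ∈ₗ E → EdgeKind st (own T) p q
edgeKind base edge₀ = left-C refl (λ ()) refl
edgeKind base edge₁ = right-C refl (λ ()) refl
edgeKind (op1 T v v∈A) edge₀ = left-C refl (A≠C v∈A) refl
edgeKind (op1 T v _) (there pq) = EdgeKind-raise (λ _ → refl) (λ _ → refl) (edgeKind T) pq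
edgeKind (op2 T v v∈B) edge₀ = both-B v∈B refl
edgeKind (op2 T v _) edge₁ = right-C refl (λ ()) refl
edgeKind (op2 T v _) edge₂ = left-C refl (λ ()) refl
edgeKind (op2 T v _) edge₃ = right-C refl (λ ()) refl
edgeKind (op2 T v _) (there (there (there (there pq)))) =
  EdgeKind-raise (λ _ → refl) (λ _ → refl) (edgeKind T) pq
edgeKind (op3 T v v∈C) edge₀ = left-C v∈C (λ ()) refl
edgeKind (op3 T v _) edge₁ = both-B refl refl
edgeKind (op3 T v _) edge₂ = right-C refl (λ ()) refl
edgeKind (op3 T v _) edge₃ = left-C refl (λ ()) refl
edgeKind (op3 T v _) edge₄ = right-C refl (λ ()) refl
edgeKind (op3 T v _) (there (there (there (there (there pq))))) =
  EdgeKind-raise (λ _ → refl) (λ _ → refl) (edgeKind T) pq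

EdgeKind-sym : ∀ {n} {st : Labeling n} {o p q} → EdgeKind st o p q → EdgeKind st o q p
EdgeKind-sym (both-B p∈B q∈B) = both-B q∈B p∈B
EdgeKind-sym (left-C p∈C q∉C op≡oq) = right-C p∈C q∉C (sym op≡oq)
EdgeKind-sym (right-C q∈C p∉C op≡oq) = left-C q∈C p∉C (sym op≡oq)

adjKind : ∀ {n E st} (T : InU n E st) {p q} → Adj E p q → EdgeKind st (own T) p q
adjKind T (inj₁ pq) = edgeKind T pq
adjKind T (inj₂ qp) = EdgeKind-sym (edgeKind T qp)

C-neighbour : ∀ {n E st} (T : InU n E st) {p q} → st p ≡ C → Adj E p q →
              own T p ≡ own T q × ¬ st q ≡ C
C-neighbour T p∈C pq with adjKind T pq
... | both-B p∈B _ = ⊥-elim (B≠C p∈B p∈C)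
... | left-C _ q∉C op≡oq = op≡oq , q∉C
... | right-C _ p∉C _ = ⊥-elim (p∉C p∈C)

A-neighbour : ∀ {n E st} (T : InU n E st) {p q} → st p ≡ A → Adj E p q → st q ≡ C
A-neighbour T p∈A pq with adjKind T pq
... | both-B p∈B _ = ⊥-elim (A≠B p∈A p∈B)
... | left-C p∈C _ _ = ⊥-elim (A≠C p∈A p∈C)
... | right-C q∈C _ _ = q∈C

own-A : ∀ {n E st} (T : InU n E st) x → st x ≡ A → own T x ≡ x
own-A base 1F _ = refl
own-A base 2F ()
own-A (op1 T v _) (suc i) i∈A = cong suc (own-A T i i∈A)
own-A (op2 T v _) 2F _ = refl
own-A (op2 T v _) (old₄ i) i∈A = cong (4 ↑ʳ_) (own-A T i i∈A)
own-A (op3 T v _) 3F _ = refl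
own-A (op3 T v _) (old₅ i) i∈A = cong (5 ↑ʳ_) (own-A T i i∈A)

own-near-A : ∀ {n E st} (T : InU n E st) {x w} → st x ≡ A → Dist≤2 E x w → own T w ≡ x
own-near-A T x∈A (inj₁ xw) =
  trans (proj₁ (C-neighbour T (A-neighbour T x∈A xw) (Adj-sym xw))) (own-A T _ x∈A)
own-near-A T x∈A (inj₂ (z , xz , zw)) =
  trans (sym (proj₁ (C-neighbour T (A-neighbour T x∈A xz) zw)))
        (own-near-A T x∈A (inj₁ xz))

own-C : ∀ {n E st} (T : InU n E st) c → st c ≡ C → st (own T c) ≡ A × Adj E c (own T c)
own-C base 0F _ = refl , inj₁ edge₀
own-C base 2F _ = refl , inj₂ edge₁
own-C (op1 T v v∈A) 0F _ rewrite own-A T v v∈A = v∈A , inj₁ edge₀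
own-C (op1 T v _) (suc i) i∈C = map₂ (Adj-lift (newEdges₁ v)) (own-C T i i∈C)
own-C (op2 T v _) 1F _ = refl , inj₁ edge₂
own-C (op2 T v _) 3F _ = refl , inj₂ edge₃
own-C (op2 T v _) (old₄ i) i∈C = map₂ (Adj-lift (newEdges₂ v)) (own-C T i i∈C)
own-C (op3 T v _) 2F _ = refl , inj₁ edge₃
own-C (op3 T v _) 4F _ = refl , inj₂ edge₄
own-C (op3 T v _) (old₅ i) i∈C = map₂ (Adj-lift (newEdges₃ v)) (own-C T i i∈C)

twoNeighbours : ∀ {n E st} (T : InU n E st) x → st x ≡ A → TwoNeighbours E x
twoNeighbours base 1F _ = 0F , 2F , (λ ()) , inj₂ edge₀ , inj₁ edge₁
twoNeighbours base 2F ()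
twoNeighbours (op1 T v _) (suc i) i∈A =
  TwoNeighbours-lift (newEdges₁ v) (twoNeighbours T i i∈A)
twoNeighbours (op2 T v _) 2F _ = 1F , 3F , (λ ()) , inj₂ edge₂ , inj₁ edge₃
twoNeighbours (op2 T v _) (old₄ i) i∈A =
  TwoNeighbours-lift (newEdges₂ v) (twoNeighbours T i i∈A)
twoNeighbours (op3 T v _) 3F _ = 2F , 4F , (λ ()) , inj₂ edge₃ , inj₁ edge₄
twoNeighbours (op3 T v _) (old₅ i) i∈A =
  TwoNeighbours-lift (newEdges₃ v) (twoNeighbours T i i∈A)

-- Lower bound: every semitotal dominating set has at least 2·#A vertices

weightA : Status → ℕ
weightA A = 2
weightA B = 0
weightA C = 0

-- Twice the number of A-vertices; this is γ_t2 of a tree in 𝒰.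
twiceA : ∀ {n} → Labeling n → ℕ
twiceA {n} st = ∑[ i < n ] weightA (st i)

OwnedPair : ∀ {n} → (Fin n → Fin n) → Subset n → Fin n → Set
OwnedPair o S x = ∃₂ λ s₁ s₂ → ¬ s₁ ≡ s₂ × (s₁ ∈ S × o s₁ ≡ x) × (s₂ ∈ S × o s₂ ≡ x)

-- If x ∈ S, take x and its partner.  Otherwise take a neighbour s ∈ S of x
-- and, for a second neighbour c of x, either c itself or a neighbour of c
-- in S; the latter is not a C-vertex, so it differs from s.
ownedPair : ∀ {n E st} (T : InU n E st) (S : Subset n) → SemitotalDominating E S →
            ∀ {x} → st x ≡ A → OwnedPair (own T) S x
ownedPair T S (_ , partnered) {x} x∈A with x ∈? S
... | yes x∈S with partnered x x∈S
...   | w , w∈S , w≢x , xw =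
  x , w , w≢x ∘ sym , (x∈S , own-A T x x∈A) , (w∈S , own-near-A T x∈A xw)
ownedPair {st = st} T S (dominating , _) {x} x∈A | no x∉S with dominating x x∉S
... | s , s∈S , xs with another-neighbour (twoNeighbours T x x∈A) s
...   | c , c≢s , xc with c ∈? S
...     | yes c∈S =
  s , c , c≢s ∘ sym , (s∈S , own-near-A T x∈A (inj₁ xs)) , (c∈S , own-near-A T x∈A (inj₁ xc))
...     | no c∉S with dominating c c∉S
...       | t , t∈S , ct = s , t , s≢t , (s∈S , own-near-A T x∈A (inj₁ xs)) , (t∈S , t-owned)
  where
  c∈C : st c ≡ C
  c∈C = A-neighbour T x∈A xc
  t-owned : own T t ≡ x
  t-owned = trans (sym (proj₁ (C-neighbour T c∈C ct))) (own-near-A T x∈A (inj₁ xc))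
  s≢t : ¬ s ≡ t
  s≢t refl = proj₂ (C-neighbour T c∈C ct) (A-neighbour T x∈A xs)

ownedPair-fibre : ∀ {n} {o : Fin n → Fin n} {S x} → OwnedPair o S x → 2 ≤ fibre o x (indicator S)
ownedPair-fibre {o = o} {S} {x} (s₁ , s₂ , s₁≢s₂ , owned₁ , owned₂) =
  ≤-trans (+-mono-≤ (counted owned₁) (counted owned₂)) (∑-≥-pair _ s₁ s₂ s₁≢s₂)
  where
  counted : ∀ {s} → s ∈ S × o s ≡ x → 1 ≤ (if does (o s ≟F x) then indicator S s else 0)
  counted {s} (s∈S , os≡x) with o s ≟F x
  ... | no os≢x = ⊥-elim (os≢x os≡x)
  ... | yes _ rewrite []=⇒lookup s∈S = s≤s z≤n

-- |S| is the sum over x of the part of S owned by x, and that part has at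
-- least 2 elements whenever x is an A-vertex.
lower-bound : ∀ {n E st} (T : InU n E st) (S : Subset n) →
              SemitotalDominating E S → twiceA st ≤ ∣ S ∣
lower-bound {n} {st = st} T S semitotal = begin
  twiceA st                                   ≤⟨ ∑-mono weight≤fibre ⟩
  ∑[ x < n ] fibre (own T) x (indicator S)    ≡⟨ ∑-fibres (own T) (indicator S) ⟨
  ∑[ i < n ] indicator S i                    ≡⟨ ∣∣≡∑indicator S ⟨
  ∣ S ∣                                       ∎
  where
  open ≤-Reasoning
  weight≤fibre : ∀ x → weightA (st x) ≤ fibre (own T) x (indicator S)
  weight≤fibre x with st x in x-status
  ... | A = ownedPair-fibre (ownedPair T S semitotal x-status)
  ... | B = z≤n
  ... | C = z≤n

-- Upper bound: sets built along the construction of 𝒰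

Partner : ∀ {n} → Edges n → Subset n → Fin n → Set
Partner E D u = ∃ λ w → w ∈ D × ¬ w ≡ u × Dist≤2 E u w

Everyone : ∀ {n} → Fin n → Set
Everyone _ = ⊤

Avoiding : ∀ {n} → Fin n → Fin n → Set
Avoiding x u = ¬ u ≡ x

-- D is dominating, contains every A-vertex, and each u ∈ D with Q u has a
-- partner.  Q = Everyone gives semitotal sets, Q = Avoiding x almost
-- semitotal sets relative to x.
record Good {n} (E : Edges n) (st : Labeling n) (Q : Fin n → Set) (D : Subset n) : Set where
  constructor good
  field
    dominating : Dominating E D
    partnered  : ∀ u → u ∈ D → Q u → Partner E D u
    containsA  : ∀ y → st y ≡ A → y ∈ D

∈-lift : ∀ {k n} (bs : Vec Bool k) {D : Subset n} {i} → i ∈ D → (k ↑ʳ i) ∈ (bs ++ᵥ D)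
∈-lift [] i∈D = i∈D
∈-lift (_ ∷ bs) i∈D = there (∈-lift bs i∈D)

∈-unlift : ∀ {k n} (bs : Vec Bool k) {D : Subset n} {i} → (k ↑ʳ i) ∈ (bs ++ᵥ D) → i ∈ D
∈-unlift [] i∈D = i∈D
∈-unlift (_ ∷ bs) (there i∈D) = ∈-unlift bs i∈D

dominated-lift : ∀ {k n} (es : Edges (k + n)) (bs : Vec Bool k) {E : Edges n} {D : Subset n} →
                 Dominating E D → ∀ i → (k ↑ʳ i) ∉ (bs ++ᵥ D) →
                 ∃ λ u → u ∈ (bs ++ᵥ D) × Adj (es ++ raiseE k E) (k ↑ʳ i) u
dominated-lift {k} es bs dominating i i∉D with dominating i (i∉D ∘ ∈-lift bs)
... | u , u∈D , iu = k ↑ʳ u , ∈-lift bs u∈D , Adj-lift es iu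

partner-lift : ∀ {k n} (es : Edges (k + n)) (bs : Vec Bool k) {E : Edges n} {D : Subset n} {u} →
               Partner E D u → Partner (es ++ raiseE k E) (bs ++ᵥ D) (k ↑ʳ u)
partner-lift {k} es bs (w , w∈D , w≢u , uw) =
  k ↑ʳ w , ∈-lift bs w∈D , w≢u ∘ ↑ʳ-injective k w _ , Dist≤2-lift es uw

avoiding-lift : ∀ k {n} {x : Fin n} u → Avoiding (k ↑ʳ x) (k ↑ʳ u) → Avoiding x u
avoiding-lift k u k↑u≢k↑x = k↑u≢k↑x ∘ cong (k ↑ʳ_)

everyone-lift : ∀ k {n} (u : Fin n) → Everyone (k ↑ʳ u) → Everyone u
everyone-lift _ _ _ = tt

record Witnesses {n} (E : Edges n) (st : Labeling n) : Set where
  field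
    semitotal     : ∃ λ S → Good E st Everyone S × ∣ S ∣ ≡ twiceA st
    semitotalWith : ∀ b → st b ≡ B →
                    ∃ λ S → Good E st Everyone S × b ∈ S × ∣ S ∣ ≡ twiceA st
    almost        : ∀ x → st x ≡ A →
                    ∃ λ D → Good E st (Avoiding x) D × suc ∣ D ∣ ≡ twiceA st
open Witnesses

P₃-edges : Edges 3
P₃-edges = (0F , 1F) ∷ (1F , 2F) ∷ []

P₃-status : Labeling 3
P₃-status = C ∷ᵛ A ∷ᵛ C ∷ᵛ []ᵛ

witnesses-base : Witnesses P₃-edges P₃-status
semitotal witnesses-base = true ∷ true ∷ false ∷ [] , good dominating partnered containsA , refl
  where
  dominating : Dominating P₃-edges (true ∷ true ∷ false ∷ [])
  dominating 2F _ = 1F , there here , inj₂ edge₁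
  dominating 0F 0∉S = ⊥-elim (0∉S here)
  dominating 1F 1∉S = ⊥-elim (1∉S (there here))
  partnered : ∀ u → u ∈ (true ∷ true ∷ false ∷ []) → ⊤ → Partner P₃-edges (true ∷ true ∷ false ∷ []) u
  partnered 0F _ _ = 1F , there here , (λ ()) , inj₁ (inj₁ edge₀)
  partnered 1F _ _ = 0F , here , (λ ()) , inj₁ (inj₂ edge₀)
  partnered 2F (there (there ())) _
  containsA : ∀ y → P₃-status y ≡ A → y ∈ (true ∷ true ∷ false ∷ [])
  containsA 1F _ = there here
  containsA 2F ()
semitotalWith witnesses-base 0F ()
semitotalWith witnesses-base 1F ()
semitotalWith witnesses-base 2F ()
almost witnesses-base 1F _ = false ∷ true ∷ false ∷ [] , good dominating partnered containsA , refl
  where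
  dominating : Dominating P₃-edges (false ∷ true ∷ false ∷ [])
  dominating 0F _ = 1F , there here , inj₁ edge₀
  dominating 1F 1∉D = ⊥-elim (1∉D (there here))
  dominating 2F _ = 1F , there here , inj₂ edge₁
  partnered : ∀ u → u ∈ (false ∷ true ∷ false ∷ []) → Avoiding 1F u →
              Partner P₃-edges (false ∷ true ∷ false ∷ []) u
  partnered 1F _ 1≢1 = ⊥-elim (1≢1 refl)
  partnered 2F (there (there ())) _
  containsA : ∀ y → P₃-status y ≡ A → y ∈ (false ∷ true ∷ false ∷ [])
  containsA 1F _ = there here
  containsA 2F ()
almost witnesses-base 2F ()

extend₁ : ∀ {n E st} {v : Fin n} → st v ≡ A → ∀ {Q Q′ D} → Good E st Q D →
          (∀ u → Q′ (suc u) → Q u) →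
          Good (newEdges₁ v ++ raiseE 1 E) (C ∷ᵛ st) Q′ (false ∷ D)
extend₁ {n} {E} {st} {v} v∈A {Q} {Q′} {D} (good dominating partnered containsA) Q′⇒Q =
  good dominating′ partnered′ containsA′
  where
  E′ : Edges (1 + n)
  E′ = newEdges₁ v ++ raiseE 1 E
  dominating′ : Dominating E′ (false ∷ D)
  dominating′ 0F _ = suc v , there (containsA v v∈A) , inj₁ edge₀
  dominating′ (suc i) i∉D = dominated-lift (newEdges₁ v) (false ∷ []) dominating i i∉D
  partnered′ : ∀ u → u ∈ (false ∷ D) → Q′ u → Partner E′ (false ∷ D) u
  partnered′ (suc u) (there u∈D) q =
    partner-lift (newEdges₁ v) (false ∷ []) (partnered u u∈D (Q′⇒Q u q))
  containsA′ : ∀ y → (C ∷ᵛ st) y ≡ A → y ∈ (false ∷ D)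
  containsA′ (suc y) y∈A = there (containsA y y∈A)

witnesses₁ : ∀ {n E st} {v : Fin n} → st v ≡ A → Witnesses E st →
             Witnesses (newEdges₁ v ++ raiseE 1 E) (C ∷ᵛ st)
semitotal (witnesses₁ v∈A W) with semitotal W
... | S , S-good , size = false ∷ S , extend₁ v∈A S-good (everyone-lift 1) , size
semitotalWith (witnesses₁ v∈A W) (suc b) b∈B with semitotalWith W b b∈B
... | S , S-good , b∈S , size = false ∷ S , extend₁ v∈A S-good (everyone-lift 1) , there b∈S , size
almost (witnesses₁ v∈A W) (suc x) x∈A with almost W x x∈A
... | D , D-good , size = false ∷ D , extend₁ v∈A D-good (avoiding-lift 1) , size

Status₂ : ∀ {n} → Labeling n → Labeling (4 + n)
Status₂ st = (B ∷ᵛ C ∷ᵛ A ∷ᵛ C ∷ᵛ []ᵛ) ++ᵛ st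

extend₂ : ∀ {n E st} {v : Fin n} {Q Q′ D} → Good E st Q D →
          (∀ u → Q′ (4 ↑ʳ u) → Q u) →
          Good (newEdges₂ v ++ raiseE 4 E) (Status₂ st) Q′ (false ∷ true ∷ true ∷ false ∷ D)
extend₂ {n} {E} {st} {v} {Q} {Q′} {D} (good dominating partnered containsA) Q′⇒Q =
  good dominating′ partnered′ containsA′
  where
  E′ : Edges (4 + n)
  E′ = newEdges₂ v ++ raiseE 4 E
  bs : Vec Bool 4
  bs = false ∷ true ∷ true ∷ false ∷ []
  dominating′ : Dominating E′ (bs ++ᵥ D)
  dominating′ 0F _ = 1F , there here , inj₁ edge₁
  dominating′ 1F 1∉D = ⊥-elim (1∉D (there here))
  dominating′ 2F 2∉D = ⊥-elim (2∉D (there (there here)))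
  dominating′ 3F _ = 2F , there (there here) , inj₂ edge₃
  dominating′ (old₄ i) i∉D = dominated-lift (newEdges₂ v) bs dominating i i∉D
  partnered′ : ∀ u → u ∈ (bs ++ᵥ D) → Q′ u → Partner E′ (bs ++ᵥ D) u
  partnered′ 1F _ _ = 2F , there (there here) , (λ ()) , inj₁ (inj₁ edge₂)
  partnered′ 2F _ _ = 1F , there here , (λ ()) , inj₁ (inj₂ edge₂)
  partnered′ 3F (there (there (there ()))) _
  partnered′ (old₄ u) u∈D q =
    partner-lift (newEdges₂ v) bs (partnered u (∈-unlift bs u∈D) (Q′⇒Q u q))
  containsA′ : ∀ y → Status₂ st y ≡ A → y ∈ (bs ++ᵥ D)
  containsA′ 2F _ = there (there here)
  containsA′ (old₄ y) y∈A = ∈-lift bs (containsA y y∈A)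

witnesses₂ : ∀ {n E st} {v : Fin n} → st v ≡ B → Witnesses E st →
             Witnesses (newEdges₂ v ++ raiseE 4 E) (Status₂ st)
semitotal (witnesses₂ v∈B W) with semitotal W
... | S , S-good , size = _ , extend₂ S-good (everyone-lift 4) , cong (2 +_) size
semitotalWith (witnesses₂ v∈B W) (old₄ b) b∈B with semitotalWith W b b∈B
... | S , S-good , b∈S , size =
  _ , extend₂ S-good (everyone-lift 4) , ∈-lift (false ∷ true ∷ true ∷ false ∷ []) b∈S , cong (2 +_) size
almost (witnesses₂ v∈B W) (old₄ x) x∈A with almost W x x∈A
... | D , D-good , size = _ , extend₂ D-good (avoiding-lift 4) , cong (2 +_) size
-- The new B-vertex joins the set; it is partnered by v.
semitotalWith (witnesses₂ {E = E} {st} {v} v∈B W) 0F _ with semitotalWith W v v∈B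
... | S , good dominating partnered containsA , v∈S , size =
  bs ++ᵥ S , good dominating′ partnered′ containsA′ , here , cong (2 +_) size
  where
  bs : Vec Bool 4
  bs = true ∷ false ∷ true ∷ false ∷ []
  dominating′ : Dominating (newEdges₂ v ++ raiseE 4 E) (bs ++ᵥ S)
  dominating′ 0F 0∉D = ⊥-elim (0∉D here)
  dominating′ 1F _ = 0F , here , inj₂ edge₁
  dominating′ 2F 2∉D = ⊥-elim (2∉D (there (there here)))
  dominating′ 3F _ = 2F , there (there here) , inj₂ edge₃
  dominating′ (old₄ i) i∉D = dominated-lift (newEdges₂ v) bs dominating i i∉D
  partnered′ : ∀ u → u ∈ (bs ++ᵥ S) → ⊤ → Partner (newEdges₂ v ++ raiseE 4 E) (bs ++ᵥ S) u
  partnered′ 0F _ _ = old₄ v , ∈-lift bs v∈S , (λ ()) , inj₁ (inj₂ edge₀)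
  partnered′ 1F (there ()) _
  partnered′ 2F _ _ = 0F , here , (λ ()) , inj₂ (1F , inj₂ edge₂ , inj₂ edge₁)
  partnered′ 3F (there (there (there ()))) _
  partnered′ (old₄ u) u∈D _ = partner-lift (newEdges₂ v) bs (partnered u (∈-unlift bs u∈D) tt)
  containsA′ : ∀ y → Status₂ st y ≡ A → y ∈ (bs ++ᵥ S)
  containsA′ 2F _ = there (there here)
  containsA′ (old₄ y) y∈A = ∈-lift bs (containsA y y∈A)
-- The new A-vertex is the exception; the new B-vertex is dominated by v.
almost (witnesses₂ {E = E} {st} {v} v∈B W) 2F _ with semitotalWith W v v∈B
... | S , good dominating partnered containsA , v∈S , size =
  bs ++ᵥ S , good dominating′ partnered′ containsA′ , cong (2 +_) size
  where
  bs : Vec Bool 4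
  bs = false ∷ false ∷ true ∷ false ∷ []
  dominating′ : Dominating (newEdges₂ v ++ raiseE 4 E) (bs ++ᵥ S)
  dominating′ 0F _ = old₄ v , ∈-lift bs v∈S , inj₂ edge₀
  dominating′ 1F _ = 2F , there (there here) , inj₁ edge₂
  dominating′ 2F 2∉D = ⊥-elim (2∉D (there (there here)))
  dominating′ 3F _ = 2F , there (there here) , inj₂ edge₃
  dominating′ (old₄ i) i∉D = dominated-lift (newEdges₂ v) bs dominating i i∉D
  partnered′ : ∀ u → u ∈ (bs ++ᵥ S) → Avoiding 2F u → Partner (newEdges₂ v ++ raiseE 4 E) (bs ++ᵥ S) u
  partnered′ 1F (there ()) _
  partnered′ 2F _ 2≢2 = ⊥-elim (2≢2 refl)
  partnered′ 3F (there (there (there ()))) _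
  partnered′ (old₄ u) u∈D _ = partner-lift (newEdges₂ v) bs (partnered u (∈-unlift bs u∈D) tt)
  containsA′ : ∀ y → Status₂ st y ≡ A → y ∈ (bs ++ᵥ S)
  containsA′ 2F _ = there (there here)
  containsA′ (old₄ y) y∈A = ∈-lift bs (containsA y y∈A)

Status₃ : ∀ {n} → Labeling n → Labeling (5 + n)
Status₃ st = (B ∷ᵛ B ∷ᵛ C ∷ᵛ A ∷ᵛ C ∷ᵛ []ᵛ) ++ᵛ st

extend₃ : ∀ {n E st} {v : Fin n} {Q Q′ D} → Good E st Q D →
          (∀ u → Q′ (5 ↑ʳ u) → Q u) →
          Good (newEdges₃ v ++ raiseE 5 E) (Status₃ st) Q′ (false ∷ true ∷ false ∷ true ∷ false ∷ D)
extend₃ {n} {E} {st} {v} {Q} {Q′} {D} (good dominating partnered containsA) Q′⇒Q =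
  good dominating′ partnered′ containsA′
  where
  E′ : Edges (5 + n)
  E′ = newEdges₃ v ++ raiseE 5 E
  bs : Vec Bool 5
  bs = false ∷ true ∷ false ∷ true ∷ false ∷ []
  dominating′ : Dominating E′ (bs ++ᵥ D)
  dominating′ 0F _ = 1F , there here , inj₁ edge₁
  dominating′ 1F 1∉D = ⊥-elim (1∉D (there here))
  dominating′ 2F _ = 1F , there here , inj₂ edge₂
  dominating′ 3F 3∉D = ⊥-elim (3∉D (there (there (there here))))
  dominating′ 4F _ = 3F , there (there (there here)) , inj₂ edge₄
  dominating′ (old₅ i) i∉D = dominated-lift (newEdges₃ v) bs dominating i i∉D
  partnered′ : ∀ u → u ∈ (bs ++ᵥ D) → Q′ u → Partner E′ (bs ++ᵥ D) u
  partnered′ 1F _ _ = 3F , there (there (there here)) , (λ ()) , inj₂ (2F , inj₁ edge₂ , inj₁ edge₃)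
  partnered′ 2F (there (there ())) _
  partnered′ 3F _ _ = 1F , there here , (λ ()) , inj₂ (2F , inj₂ edge₃ , inj₂ edge₂)
  partnered′ 4F (there (there (there (there ())))) _
  partnered′ (old₅ u) u∈D q =
    partner-lift (newEdges₃ v) bs (partnered u (∈-unlift bs u∈D) (Q′⇒Q u q))
  containsA′ : ∀ y → Status₃ st y ≡ A → y ∈ (bs ++ᵥ D)
  containsA′ 3F _ = there (there (there here))
  containsA′ (old₅ y) y∈A = ∈-lift bs (containsA y y∈A)

-- When the first new vertex is in the set, an old vertex a adjacent to v
-- gets it as a partner, so a may come from a set that avoids partnering a.
partner-old₃ : ∀ {n} {E : Edges n} {v a : Fin n} (bs : Vec Bool 4) {D : Subset n} →
               Adj E v a → (∀ u → u ∈ D → Avoiding a u → Partner E D u) →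
               ∀ u → u ∈ D → Partner (newEdges₃ v ++ raiseE 5 E) (true ∷ bs ++ᵥ D) (5 ↑ʳ u)
partner-old₃ {v = v} {a} bs va partnered u u∈D with u ≟F a
... | yes refl = 0F , here , (λ ()) , inj₂ (5 ↑ʳ v , Adj-lift (newEdges₃ v) (Adj-sym va) , inj₁ edge₀)
... | no u≢a = partner-lift (newEdges₃ v) (true ∷ bs) (partnered u u∈D u≢a)

witnesses₃ : ∀ {n E st} (T : InU n E st) {v : Fin n} → st v ≡ C → Witnesses E st →
             Witnesses (newEdges₃ v ++ raiseE 5 E) (Status₃ st)
semitotal (witnesses₃ T v∈C W) with semitotal W
... | S , S-good , size = _ , extend₃ S-good (everyone-lift 5) , cong (2 +_) size
semitotalWith (witnesses₃ T v∈C W) 1F _ with semitotal W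
... | S , S-good , size = _ , extend₃ S-good (everyone-lift 5) , there here , cong (2 +_) size
semitotalWith (witnesses₃ T v∈C W) (old₅ b) b∈B with semitotalWith W b b∈B
... | S , S-good , b∈S , size =
  _ , extend₃ S-good (everyone-lift 5) , ∈-lift (false ∷ true ∷ false ∷ true ∷ false ∷ []) b∈S ,
  cong (2 +_) size
almost (witnesses₃ T v∈C W) (old₅ x) x∈A with almost W x x∈A
... | D , D-good , size = _ , extend₃ D-good (avoiding-lift 5) , cong (2 +_) size
-- The first new vertex joins the set; the owner a of v may then come from
-- an almost semitotal set relative to a, as it is partnered by the new vertex.
semitotalWith (witnesses₃ {E = E} {st} T {v} v∈C W) 0F _ with own-C T v v∈C
... | a∈A , va with almost W (own T v) a∈A
...   | S , good dominating partnered containsA , size =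
  true ∷ bs ++ᵥ S , good dominating′ partnered′ containsA′ , here , cong (2 +_) size
  where
  bs : Vec Bool 4
  bs = false ∷ true ∷ true ∷ false ∷ []
  dominating′ : Dominating (newEdges₃ v ++ raiseE 5 E) (true ∷ bs ++ᵥ S)
  dominating′ 0F 0∉D = ⊥-elim (0∉D here)
  dominating′ 1F _ = 0F , here , inj₂ edge₁
  dominating′ 2F 2∉D = ⊥-elim (2∉D (there (there here)))
  dominating′ 3F 3∉D = ⊥-elim (3∉D (there (there (there here))))
  dominating′ 4F _ = 3F , there (there (there here)) , inj₂ edge₄
  dominating′ (old₅ i) i∉D = dominated-lift (newEdges₃ v) (true ∷ bs) dominating i i∉D
  partnered′ : ∀ u → u ∈ (true ∷ bs ++ᵥ S) → ⊤ → Partner (newEdges₃ v ++ raiseE 5 E) (true ∷ bs ++ᵥ S) u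
  partnered′ 0F _ _ = 2F , there (there here) , (λ ()) , inj₂ (1F , inj₁ edge₁ , inj₁ edge₂)
  partnered′ 1F (there ()) _
  partnered′ 2F _ _ = 3F , there (there (there here)) , (λ ()) , inj₁ (inj₁ edge₃)
  partnered′ 3F _ _ = 2F , there (there here) , (λ ()) , inj₁ (inj₂ edge₃)
  partnered′ 4F (there (there (there (there ())))) _
  partnered′ (old₅ u) u∈D _ = partner-old₃ bs va partnered u (∈-unlift (true ∷ bs) u∈D)
  containsA′ : ∀ y → Status₃ st y ≡ A → y ∈ (true ∷ bs ++ᵥ S)
  containsA′ 3F _ = there (there (there here))
  containsA′ (old₅ y) y∈A = ∈-lift (true ∷ bs) (containsA y y∈A)
-- The new A-vertex is the exception; the first new vertex is partnered by
-- the owner a of v, which is partnered by it in turn.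
almost (witnesses₃ {E = E} {st} T {v} v∈C W) 3F _ with own-C T v v∈C
... | a∈A , va with almost W (own T v) a∈A
...   | S , good dominating partnered containsA , size =
  true ∷ bs ++ᵥ S , good dominating′ partnered′ containsA′ , cong (2 +_) size
  where
  bs : Vec Bool 4
  bs = false ∷ false ∷ true ∷ false ∷ []
  dominating′ : Dominating (newEdges₃ v ++ raiseE 5 E) (true ∷ bs ++ᵥ S)
  dominating′ 0F 0∉D = ⊥-elim (0∉D here)
  dominating′ 1F _ = 0F , here , inj₂ edge₁
  dominating′ 2F _ = 3F , there (there (there here)) , inj₁ edge₃
  dominating′ 3F 3∉D = ⊥-elim (3∉D (there (there (there here))))
  dominating′ 4F _ = 3F , there (there (there here)) , inj₂ edge₄
  dominating′ (old₅ i) i∉D = dominated-lift (newEdges₃ v) (true ∷ bs) dominating i i∉D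
  partnered′ : ∀ u → u ∈ (true ∷ bs ++ᵥ S) → Avoiding 3F u →
               Partner (newEdges₃ v ++ raiseE 5 E) (true ∷ bs ++ᵥ S) u
  partnered′ 0F _ _ =
    5 ↑ʳ own T v , ∈-lift (true ∷ bs) (containsA _ a∈A) , (λ ()) ,
    inj₂ (5 ↑ʳ v , inj₂ edge₀ , Adj-lift (newEdges₃ v) va)
  partnered′ 1F (there ()) _
  partnered′ 2F (there (there ())) _
  partnered′ 3F _ 3≢3 = ⊥-elim (3≢3 refl)
  partnered′ 4F (there (there (there (there ())))) _
  partnered′ (old₅ u) u∈D _ = partner-old₃ bs va partnered u (∈-unlift (true ∷ bs) u∈D)
  containsA′ : ∀ y → Status₃ st y ≡ A → y ∈ (true ∷ bs ++ᵥ S)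
  containsA′ 3F _ = there (there (there here))
  containsA′ (old₅ y) y∈A = ∈-lift (true ∷ bs) (containsA y y∈A)

witnesses : ∀ {n E st} → InU n E st → Witnesses E st
witnesses base = witnesses-base
witnesses (op1 T v v∈A) = witnesses₁ v∈A (witnesses T)
witnesses (op2 T v v∈B) = witnesses₂ v∈B (witnesses T)
witnesses (op3 T v v∈C) = witnesses₃ T v∈C (witnesses T)

γt2≡twiceA : ∀ {n E st} → InU n E st → ∀ {k} → IsGammaT2 E k → k ≡ twiceA st
γt2≡twiceA T ((S₀ , S₀-semitotal , ∣S₀∣≡k) , minimum) with semitotal (witnesses T)
... | S , good dominating partnered _ , ∣S∣≡2A =
  ≤-antisym (subst (_ ≤_) ∣S∣≡2A (minimum S (dominating , λ u u∈S → partnered u u∈S tt)))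
            (subst (_ ≤_) ∣S₀∣≡k (lower-bound T S₀ S₀-semitotal))

lemma2p8 : ∀ (n : ℕ) (E : Edges n) (st : Labeling n) → InU n E st →
    ∀ (x : Fin n) → st x ≡ A →
    ∀ (k : ℕ) → IsGammaT2 E k →
    ∃ λ (D : Subset n) → AlmostSemitotalDominating E x D × ∣ D ∣ + 1 ≡ k
lemma2p8 n E st T x x∈A k γt2≡k with almost (witnesses T) x x∈A
... | D , good dominating partnered _ , ∣D∣+1≡2A =
  D , (dominating , partnered) ,
  trans (+-comm ∣ D ∣ 1) (trans ∣D∣+1≡2A (sym (γt2≡twiceA T γt2≡k)))
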